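{- Fix $w\in\mathfrak{S}_n$. For every $v\in\mathfrak{S}_n$ we have $v\ge_R v'$ in the right weak order.
   Context: Permutations are in one-line notation; $s_i$ is the simple transposition $(i,i+1)$ and $\ell$ is length. Right weak order: $u_1\le_R u_2$ iff $u_2=u_1s_{i_1}\cdots s_{i_k}$ for some simple reflections with $\ell(u_1s_{i_1}\cdots s_{i_j})=\ell(u_1)+j$ for $0\le j\le k$. For a set of integers $S$, $S\!\uparrow$ is the increasing tuple of its elements; $w^{(d)}=\{w(1),\dots,w(d)\}\!\uparrow$; increasing $d$-tuples are compared componentwise. For $v\in\mathfrak{S}_n$ define inductively $i_1=\min\{i: v(i)\le w(1)\}$ and for $k\ge2$, $i_k=\min\{i\in[n]\setminus\{i_1,\dots,i_{k-1}\} : \{v(i_1),\dots,v(i_{k-1}),v(i)\}\!\uparrow\le w^{(k)}\}$; $v'=v(i_1)\cdots v(i_n)$. -}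

module Defs where

open import Data.Nat using (ℕ; zero; suc; _+_; _≤_; _<_; _<ᵇ_)
open import Data.Nat.Properties using (≤-decTotalOrder; _≤?_)
open import Data.Fin using (Fin; toℕ; _≟_)
open import Data.Fin.Permutation using (Permutation′; _⟨$⟩ʳ_)
import Data.Fin.Permutation.Components as PC
open import Data.List using (List; []; _∷_; _++_; map; filter; take; length)
open import Data.List.Relation.Binary.Pointwise using (Pointwise; decidable)
open import Data.List.Sort.InsertionSort ≤-decTotalOrder using (sort)
open import Data.Vec using (Vec; []; _∷_; lookup)
import Data.Vec as Vec

import Data.List as L
open import Data.Maybe using (Maybe; just; nothing; _>>=_)
import Data.Maybe as Maybe
open import Data.Product using (Σ; _×_; _,_)
open import Relation.Binary.PropositionalEquality using (_≡_; _≗_)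
open import Relation.Nullary using (Dec; yes; no)

-- Permutations of [n] are stdlib permutations of Fin n (positions and
-- values 1..n are encoded as 0..n-1; the order is preserved).

positions : (n : ℕ) → List (Fin n)
positions n = L.allFin n

inv : {n : ℕ} → (Fin n → Fin n) → ℕ
inv {n} u = length (filter (λ p → decInv p) pairs)
  where
  pairs : List (Σ (Fin n) (λ _ → Fin n))
  pairs = L.concatMap (λ i → map (λ j → (i , j)) (positions n)) (positions n)
  decInv : (p : Σ (Fin n) (λ _ → Fin n)) →
           Dec ((toℕ (Data.Product.proj₁ p) < toℕ (Data.Product.proj₂ p)) ×
                (toℕ (u (Data.Product.proj₂ p)) < toℕ (u (Data.Product.proj₁ p))))
  decInv (i , j) = Relation.Nullary.Decidable._×-dec_
                     (suc (toℕ i) ≤? toℕ j) (suc (toℕ (u j)) ≤? toℕ (u i))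
    where import Relation.Nullary.Decidable

SimpleRefl : ℕ → Set
SimpleRefl n = Σ (Fin n) λ i → Σ (Fin n) λ j → toℕ j ≡ suc (toℕ i)

rmul : {n : ℕ} → (Fin n → Fin n) → SimpleRefl n → (Fin n → Fin n)
rmul u (i , j , _) k = u (PC.transpose i j k)

rmulWord : {n : ℕ} → (Fin n → Fin n) → List (SimpleRefl n) → (Fin n → Fin n)
rmulWord u [] = u
rmulWord u (s ∷ ss) = rmulWord (rmul u s) ss

_≤R_ : {n : ℕ} → (Fin n → Fin n) → (Fin n → Fin n) → Set
_≤R_ {n} u₁ u₂ =
  Σ (List (SimpleRefl n)) λ ss →
    (u₂ ≗ rmulWord u₁ ss) ×
    ((j : ℕ) → j ≤ length ss → inv (rmulWord u₁ (take j ss)) ≡ inv u₁ + j)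

sortedVals : {n : ℕ} → List (Fin n) → List ℕ
sortedVals xs = sort (map toℕ xs)

wUpTo : {n : ℕ} → Permutation′ n → ℕ → List ℕ
wUpTo {n} w k = sortedVals (map (w ⟨$⟩ʳ_) (take k (positions n)))

_≤tup_ : List ℕ → List ℕ → Set
xs ≤tup ys = Pointwise _≤_ xs ys

_≤tup?_ : (xs ys : List ℕ) → Dec (xs ≤tup ys)
xs ≤tup? ys = decidable _≤?_ xs ys

-- first (= least, since lists of positions are increasing) element of a
-- list satisfying a decidable predicate
firstSat : {A : Set} {P : A → Set} → ((a : A) → Dec (P a)) → List A → Maybe A
firstSat P? [] = nothing
firstSat P? (a ∷ as) with P? a
... | yes _ = just a
... | no  _ = firstSat P? as

-- the condition defining i_k, given the already chosen i_1,…,i_{k-1}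
-- (k = length ch + 1): i ∉ {i_1,…,i_{k-1}} and
-- {v(i_1),…,v(i_{k-1}),v(i)}↑ ≤ w^(k).   (For k = 1 this is v(i) ≤ w(1).)
Cand : {n : ℕ} → Permutation′ n → Permutation′ n → List (Fin n) → Fin n → Set
Cand w v ch i =
  (i L.∉ ch) × (sortedVals (map (v ⟨$⟩ʳ_) (ch ++ (i ∷ []))) ≤tup wUpTo w (suc (length ch)))
  where import Data.List.Membership.Propositional as L

cand? : {n : ℕ} (w v : Permutation′ n) (ch : List (Fin n)) (i : Fin n) → Dec (Cand w v ch i)
cand? {n} w v ch i = Relation.Nullary.Decidable._×-dec_ (i ∉? ch)
  (sortedVals (map (v ⟨$⟩ʳ_) (ch ++ (i ∷ []))) ≤tup? wUpTo w (suc (length ch)))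
  where
  import Relation.Nullary.Decidable
  open import Data.List.Membership.DecPropositional (_≟_ {n}) using (_∉?_)

nextIdx : {n : ℕ} → Permutation′ n → Permutation′ n → List (Fin n) → Maybe (Fin n)
nextIdx {n} w v ch = firstSat (cand? w v ch) (positions n)

greedy : {n : ℕ} → Permutation′ n → Permutation′ n → (m : ℕ) → List (Fin n) → Maybe (Vec (Fin n) m)
greedy w v zero ch = just []
greedy w v (suc m) ch = nextIdx w v ch >>= λ i →
  Maybe.map (i ∷_) (greedy w v m (ch ++ (i ∷ [])))

primeIndices : {n : ℕ} → Permutation′ n → Permutation′ n → Maybe (Vec (Fin n) n)
primeIndices {n} w v = greedy w v n []

primeOf : {n : ℕ} → Permutation′ n → Vec (Fin n) n → (Fin n → Fin n)
primeOf v is k = v ⟨$⟩ʳ lookup is k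

-- Write σ(k) = i_k, so that v′ = v ∘ σ. The greedy choice never gets stuck:
-- if the chosen values S satisfy S↑ ≤ w^(k), then adding the least value
-- missing from S gives a set bounded by w^(k+1), because w^(k) is bounded by
-- the last k entries of w^(k+1). Since i_k is the leftmost admissible
-- position, p < q and σ(q) < σ(p) force v′(p) < v′(q): otherwise σ(q) would
-- already have been admissible at step p. So every inversion of σ is an
-- ascent of v′, and v′ ≤_R v follows by induction on the inversions of σ: at
-- an adjacent descent (i, i+1) of σ, v′ s_i is one longer than v′ while σ s_i
-- has one inversion fewer and the hypothesis persists; when σ has no adjacent
-- descent it is the identity and v′ = v.

module Submission where

open import Defs
open import Data.Bool using (true; false)
open import Data.Empty using (⊥-elim)
open import Data.Nat using (ℕ; zero; suc; _+_; _∸_; _≤_; _<_; _≰_; _≤ᵇ_; z≤n; s≤s; s≤s⁻¹; z<s)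
open import Data.Nat.Properties
open import Data.Fin using (Fin; zero; suc; toℕ; fromℕ<) renaming (_≟_ to _≟ᶠ_)
open import Data.Fin.Properties using (toℕ-injective; toℕ-fromℕ<; fromℕ<-toℕ; toℕ<n; any?)
  renaming (suc-injective to Fin-suc-injective)
open import Data.Fin.Permutation using (Permutation′; _⟨$⟩ʳ_; _⟨$⟩ˡ_; inverseˡ; inverseʳ)
import Data.Fin.Permutation as Perm
import Data.Fin.Permutation.Components as PC
open import Data.List using (List; []; _∷_; _++_; length; drop; take; filter; tabulate; concatMap; map; allFin)
open import Data.List.Properties using (filter-++; length-++; map-tabulate; map-++; length-map; take-suc-tabulate)
open import Data.List.Membership.Propositional using (_∈_; _∉_)
open import Data.List.Membership.Propositional.Properties using (∈-map⁺; ∈-map⁻; ∈-++⁺ˡ; ∈-++⁺ʳ; ∈-allFin)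
open import Data.List.Relation.Unary.All as All using (All)
open import Data.List.Relation.Unary.Any using (here; there)
open import Data.List.Relation.Unary.Unique.Propositional using (Unique; []; _∷_)
open import Data.List.Relation.Unary.Unique.Propositional.Properties using (take⁺; allFin⁺; ++⁺; Unique[x∷xs]⇒x∉xs)
open import Data.List.Relation.Binary.Pointwise as Pointwise using ([]; _∷_; Pointwise-≡⇒≡)
open import Data.List.Relation.Binary.Permutation.Propositional using (↭-sym)
open import Data.List.Relation.Binary.Permutation.Propositional.Properties using (↭-length; ∈-resp-↭)
open import Data.List.Sort.InsertionSort ≤-decTotalOrder using (sort; insert)
open import Data.List.Sort.InsertionSort.Properties ≤-decTotalOrder using (insert-swap; insert-↭; sort-↭)
open import Data.Vec using (Vec; []; _∷_; lookup)
open import Data.Maybe using (just)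
open import Data.Product using (Σ; ∃; _×_; _,_; proj₁; proj₂)
open import Algebra.Properties.CommutativeMonoid.Sum +-0-commutativeMonoid
  using (sum; sum-syntax; sum-cong-≗; sum-replicate-zero; ∑-distrib-+; sum-permute)
open import Function using (_∘_)
open import Function.Bundles using (Injection)
open import Function.Definitions using (Injective)
open import Function.Properties.Inverse using (↔⇒↣)
open import Relation.Nullary using (¬_; Dec; yes; no)
open import Relation.Nullary.Decidable using (_×-dec_; dec-true; dec-false)
open import Relation.Binary.PropositionalEquality

insert-≤ : ∀ {x y} ys → x ≤ y → insert x (y ∷ ys) ≡ x ∷ y ∷ ys
insert-≤ {x} {y} ys x≤y with x ≤ᵇ y | ≤⇒≤ᵇ x≤y
... | true | _ = refl

insert-≰ : ∀ {x y} ys → x ≰ y → insert x (y ∷ ys) ≡ y ∷ insert x ys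
insert-≰ {x} {y} ys x≰y with x ≤ᵇ y | ≤ᵇ⇒≤ x y
... | true  | ≤ᵇ⇒x≤y = ⊥-elim (x≰y (≤ᵇ⇒x≤y _))
... | false | _      = refl

sort-∷ʳ : ∀ xs x → sort (xs ++ x ∷ []) ≡ insert x (sort xs)
sort-∷ʳ []       x = refl
sort-∷ʳ (y ∷ xs) x rewrite sort-∷ʳ xs x = Pointwise-≡⇒≡ (insert-swap y x (sort xs))

length-insert : ∀ x xs → length (insert x xs) ≡ suc (length xs)
length-insert x xs = ↭-length (insert-↭ x xs)

∈-sort⁺ : ∀ {y} xs → y ∈ xs → y ∈ sort xs
∈-sort⁺ xs = ∈-resp-↭ (↭-sym (sort-↭ xs))

∈-sort⁻ : ∀ {y} xs → y ∈ sort xs → y ∈ xs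
∈-sort⁻ xs = ∈-resp-↭ (sort-↭ xs)

data Ascending : ℕ → List ℕ → Set where
  []  : ∀ {c} → Ascending c []
  _∷_ : ∀ {c x xs} → c ≤ x → Ascending (suc x) xs → Ascending c (x ∷ xs)

ascending-weaken : ∀ {c d xs} → c ≤ d → Ascending d xs → Ascending c xs
ascending-weaken c≤d []           = []
ascending-weaken c≤d (d≤x ∷ xs↑) = ≤-trans c≤d d≤x ∷ xs↑

ascending-lower-bound : ∀ {c xs y} → Ascending c xs → y ∈ xs → c ≤ y
ascending-lower-bound (c≤x ∷ xs↑) (here refl) = c≤x
ascending-lower-bound (c≤x ∷ xs↑) (there y∈) =
  ≤-trans c≤x (<⇒≤ (ascending-lower-bound xs↑ y∈))

insert-ascending : ∀ {c xs y} → Ascending c xs → c ≤ y → y ∉ xs → Ascending c (insert y xs)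
insert-ascending []                  c≤y y∉ = c≤y ∷ []
insert-ascending {xs = x ∷ xs} {y} (c≤x ∷ xs↑) c≤y y∉ with y ≤? x
... | yes y≤x rewrite insert-≤ xs y≤x = c≤y ∷ ≤∧≢⇒< y≤x (λ y≡x → y∉ (here y≡x)) ∷ xs↑
... | no y≰x  rewrite insert-≰ xs y≰x =
  c≤x ∷ insert-ascending xs↑ (≰⇒> y≰x) (λ y∈ → y∉ (there y∈))

≤tup-refl : ∀ {xs} → xs ≤tup xs
≤tup-refl = Pointwise.refl ≤-refl

≤tup-trans : ∀ {xs ys zs} → xs ≤tup ys → ys ≤tup zs → xs ≤tup zs
≤tup-trans = Pointwise.transitive ≤-trans

∷-≤tup-insert : ∀ {c x xs t} → Ascending c (x ∷ xs) → x < t → (x ∷ xs) ≤tup insert t xs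
∷-≤tup-insert {xs = []}              _                  x<t = <⇒≤ x<t ∷ []
∷-≤tup-insert {xs = y ∷ ys} {t} (_ ∷ x<y ∷ ys↑) x<t with t ≤? y
... | yes t≤y rewrite insert-≤ ys t≤y = <⇒≤ x<t ∷ ≤tup-refl
... | no t≰y  rewrite insert-≰ ys t≰y = <⇒≤ x<y ∷ ∷-≤tup-insert (x<y ∷ ys↑) (≰⇒> t≰y)

≤tup-drop-insert : ∀ {c xs} t → Ascending c xs → xs ≤tup drop 1 (insert t xs)
≤tup-drop-insert t [] = []
≤tup-drop-insert {xs = x ∷ xs} t xs↑ with t ≤? x
... | yes t≤x rewrite insert-≤ xs t≤x = ≤tup-refl
... | no t≰x  rewrite insert-≰ xs t≰x = ∷-≤tup-insert xs↑ (≰⇒> t≰x)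

insert-monoˡ-≤tup : ∀ {c xs y z} → y ≤ z → Ascending c xs → insert y xs ≤tup insert z xs
insert-monoˡ-≤tup y≤z [] = y≤z ∷ []
insert-monoˡ-≤tup {xs = x ∷ xs} {y} {z} y≤z (_ ∷ xs↑) with y ≤? x | z ≤? x
... | yes y≤x | yes z≤x rewrite insert-≤ xs y≤x | insert-≤ xs z≤x = y≤z ∷ ≤tup-refl
... | yes y≤x | no z≰x  rewrite insert-≤ xs y≤x | insert-≰ xs z≰x =
  y≤x ∷ ∷-≤tup-insert (≤-refl ∷ xs↑) (≰⇒> z≰x)
... | no y≰x  | yes z≤x = ⊥-elim (y≰x (≤-trans y≤z z≤x))
... | no y≰x  | no z≰x  rewrite insert-≰ xs y≰x | insert-≰ xs z≰x =
  ≤-refl ∷ insert-monoˡ-≤tup y≤z xs↑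

-- The least value missing from an ascending list

mex : ℕ → List ℕ → ℕ
mex c []       = c
mex c (x ∷ xs) with x ≟ c
... | yes _ = mex (suc c) xs
... | no  _ = c

≤-mex : ∀ c xs → c ≤ mex c xs
≤-mex c []       = ≤-refl
≤-mex c (x ∷ xs) with x ≟ c
... | yes _ = <⇒≤ (≤-mex (suc c) xs)
... | no  _ = ≤-refl

mex-≤-+-length : ∀ c xs → mex c xs ≤ c + length xs
mex-≤-+-length c []       = ≤-reflexive (sym (+-identityʳ c))
mex-≤-+-length c (x ∷ xs) with x ≟ c
... | yes _ = ≤-trans (mex-≤-+-length (suc c) xs) (≤-reflexive (sym (+-suc c (length xs))))
... | no  _ = m≤m+n c _

mex-∉ : ∀ {c xs} → Ascending c xs → mex c xs ∉ xs
mex-∉ {c} {x ∷ xs} (c≤x ∷ xs↑) mex∈ with x ≟ c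
mex-∉ {c} {x ∷ xs} (c≤x ∷ xs↑) (here mex≡x) | yes refl = <-irrefl (sym mex≡x) (≤-mex (suc c) xs)
mex-∉ {c} {x ∷ xs} (c≤x ∷ xs↑) (there mex∈) | yes refl = mex-∉ xs↑ mex∈
mex-∉ {c} {x ∷ xs} (c≤x ∷ xs↑) (here c≡x)   | no x≢c  = x≢c (sym c≡x)
mex-∉ {c} {x ∷ xs} (c≤x ∷ xs↑) (there c∈)   | no x≢c  =
  <-irrefl refl (≤-trans (s≤s c≤x) (ascending-lower-bound xs↑ c∈))

-- The values below mex c xs fill the first places of xs, and the i-th entry
-- of an ascending list is at least c + i.
insert-mex-≤tup : ∀ {c xs y ys} → Ascending c xs → Ascending c (y ∷ ys) → xs ≤tup ys →
                  insert (mex c xs) xs ≤tup (y ∷ ys)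
insert-mex-≤tup [] (c≤y ∷ _) [] = c≤y ∷ []
insert-mex-≤tup {c} {x ∷ xs} {y} {z ∷ zs} (c≤x ∷ xs↑) (c≤y ∷ ys↑) (x≤z ∷ xs≤zs) with x ≟ c
... | yes refl rewrite insert-≰ xs (<⇒≱ (≤-mex (suc x) xs)) =
  c≤y ∷ insert-mex-≤tup xs↑ (ascending-weaken (s≤s c≤y) ys↑) xs≤zs
... | no _ rewrite insert-≤ xs c≤x = c≤y ∷ x≤z ∷ xs≤zs

insert-mex-≤tup-insert : ∀ {xs ys} t → Ascending 0 xs → Ascending 0 ys → t ∉ ys → xs ≤tup ys →
                         insert (mex 0 xs) xs ≤tup insert t ys
insert-mex-≤tup-insert {ys = ys} t xs↑ ys↑ t∉ys xs≤ys
  with insert t ys | length-insert t ys | insert-ascending ys↑ z≤n t∉ys | ≤tup-drop-insert t ys↑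
... | []      | ()  | _    | _
... | y ∷ ys′ | _   | ys′↑ | ys≤ys′ = insert-mex-≤tup xs↑ ys′↑ (≤tup-trans xs≤ys ys≤ys′)

indicator : {P : Set} → Dec P → ℕ
indicator (yes _) = 1
indicator (no  _) = 0

indicator-yes : {P : Set} (P? : Dec P) → P → indicator P? ≡ 1
indicator-yes (yes _) _ = refl
indicator-yes (no ¬p) p = ⊥-elim (¬p p)

indicator-no : {P : Set} (P? : Dec P) → ¬ P → indicator P? ≡ 0
indicator-no (yes p) ¬p = ⊥-elim (¬p p)
indicator-no (no  _) _  = refl

indicator-cong : {P Q : Set} (P? : Dec P) (Q? : Dec Q) → (P → Q) → (Q → P) → indicator P? ≡ indicator Q?
indicator-cong (yes _) (yes _) _   _   = refl
indicator-cong (yes p) (no ¬q) P→Q _   = ⊥-elim (¬q (P→Q p))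
indicator-cong (no ¬p) (yes q) _   Q→P = ⊥-elim (¬p (Q→P q))
indicator-cong (no  _) (no  _) _   _   = refl

sum-zero : ∀ {n} (f : Fin n → ℕ) → (∀ k → f k ≡ 0) → sum f ≡ 0
sum-zero {n} f f≗0 = trans (sum-cong-≗ f≗0) (sum-replicate-zero n)

sum-indicator-≡ : ∀ {n} (j : Fin n) → sum (λ b → indicator (b ≟ᶠ j)) ≡ 1
sum-indicator-≡ {suc n} zero =
  cong suc (sum-zero {n} _ (λ b → indicator-no (suc b ≟ᶠ zero) (λ ())))
sum-indicator-≡ {suc n} (suc j) = begin
  indicator (zero ≟ᶠ suc j) + sum (λ b → indicator (suc b ≟ᶠ suc j))
    ≡⟨ cong₂ _+_ (indicator-no (zero ≟ᶠ suc j) (λ ()))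
                 (sum-cong-≗ λ b → indicator-cong (suc b ≟ᶠ suc j) (b ≟ᶠ j) Fin-suc-injective (cong suc)) ⟩
  sum (λ b → indicator (b ≟ᶠ j))
    ≡⟨ sum-indicator-≡ j ⟩
  1 ∎
  where open ≡-Reasoning

module _ {A : Set} {P : A → Set} (P? : ∀ a → Dec (P a)) where

  length-filter-tabulate : ∀ {m} (f : Fin m → A) →
    length (filter P? (tabulate f)) ≡ ∑[ k < m ] indicator (P? (f k))
  length-filter-tabulate {zero}  f = refl
  length-filter-tabulate {suc m} f with P? (f zero)
  ... | yes _ = cong suc (length-filter-tabulate (λ k → f (suc k)))
  ... | no  _ = length-filter-tabulate (λ k → f (suc k))

  length-filter-concatMap-tabulate : ∀ {B : Set} (h : B → List A) {m} (f : Fin m → B) →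
    length (filter P? (concatMap h (tabulate f))) ≡ ∑[ k < m ] length (filter P? (h (f k)))
  length-filter-concatMap-tabulate h {zero}  f = refl
  length-filter-concatMap-tabulate h {suc m} f = begin
    length (filter P? (h (f zero) ++ concatMap h (tabulate (λ k → f (suc k)))))
      ≡⟨ cong length (filter-++ P? (h (f zero)) _) ⟩
    length (filter P? (h (f zero)) ++ filter P? (concatMap h (tabulate (λ k → f (suc k)))))
      ≡⟨ length-++ (filter P? (h (f zero))) ⟩
    length (filter P? (h (f zero))) + length (filter P? (concatMap h (tabulate (λ k → f (suc k)))))
      ≡⟨ cong (length (filter P? (h (f zero))) +_) (length-filter-concatMap-tabulate h (λ k → f (suc k))) ⟩
    ∑[ k < suc m ] length (filter P? (h (f k))) ∎
    where open ≡-Reasoning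

Inversion : ∀ {m n} → (Fin m → Fin n) → Fin m → Fin m → Set
Inversion u a b = (toℕ a < toℕ b) × (toℕ (u b) < toℕ (u a))

inversion? : ∀ {n} (u : Fin n → Fin n) (a b : Fin n) → Dec (Inversion u a b)
inversion? u a b = (suc (toℕ a) ≤? toℕ b) ×-dec (suc (toℕ (u b)) ≤? toℕ (u a))

inversions : ∀ {n} → (Fin n → Fin n) → ℕ
inversions {n} u = ∑[ a < n ] ∑[ b < n ] indicator (inversion? u a b)

inv≡inversions : ∀ {n} (u : Fin n → Fin n) → inv u ≡ inversions u
inv≡inversions {n} u = begin
  length (filter inversionᵖ? (concatMap (λ a → map (a ,_) (allFin n)) (allFin n)))
    ≡⟨ length-filter-concatMap-tabulate inversionᵖ? (λ a → map (a ,_) (allFin n)) (λ a → a) ⟩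
  ∑[ a < n ] length (filter inversionᵖ? (map (a ,_) (allFin n)))
    ≡⟨ sum-cong-≗ (λ a → cong (λ ps → length (filter inversionᵖ? ps)) (map-tabulate (λ b → b) (a ,_))) ⟩
  ∑[ a < n ] length (filter inversionᵖ? (tabulate (a ,_)))
    ≡⟨ sum-cong-≗ (λ a → length-filter-tabulate inversionᵖ? (a ,_)) ⟩
  inversions u ∎
  where
  open ≡-Reasoning
  inversionᵖ? : (p : Σ (Fin n) (λ _ → Fin n)) → Dec (Inversion u (proj₁ p) (proj₂ p))
  inversionᵖ? (a , b) = inversion? u a b

inversions-cong : ∀ {n} {u u′ : Fin n → Fin n} → u ≗ u′ → inversions u ≡ inversions u′
inversions-cong u≗u′ = sum-cong-≗ λ a → sum-cong-≗ λ b →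
  indicator-cong (inversion? _ a b) (inversion? _ a b)
    (λ (a<b , ub<ua) → a<b , subst₂ (λ x y → toℕ x < toℕ y) (u≗u′ b) (u≗u′ a) ub<ua)
    (λ (a<b , ub<ua) → a<b , subst₂ (λ x y → toℕ x < toℕ y) (sym (u≗u′ b)) (sym (u≗u′ a)) ub<ua)

-- Adjacent transpositions

data AdjacentSwap (I : ℕ) : ℕ → ℕ → Set where
  left  : AdjacentSwap I I (suc I)
  right : AdjacentSwap I (suc I) I
  fixed : ∀ {x} → x ≢ I → x ≢ suc I → AdjacentSwap I x x

adjacentSwap-sym : ∀ {I x y} → AdjacentSwap I x y → AdjacentSwap I y x
adjacentSwap-sym left            = right
adjacentSwap-sym right           = left
adjacentSwap-sym (fixed x≢I x≢J) = fixed x≢I x≢J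

adjacentSwap-involutive : ∀ {I x y z} → AdjacentSwap I x y → AdjacentSwap I y z → z ≡ x
adjacentSwap-involutive left            right           = refl
adjacentSwap-involutive left            (fixed _ y≢J)   = ⊥-elim (y≢J refl)
adjacentSwap-involutive right           left            = refl
adjacentSwap-involutive right           (fixed y≢I _)   = ⊥-elim (y≢I refl)
adjacentSwap-involutive (fixed x≢I _)   left            = ⊥-elim (x≢I refl)
adjacentSwap-involutive (fixed _ x≢J)   right           = ⊥-elim (x≢J refl)
adjacentSwap-involutive (fixed _ _)     (fixed _ _)     = refl

adjacentSwap-< : ∀ {I x x′ y y′} → AdjacentSwap I x x′ → AdjacentSwap I y y′ →
                 x < y → ¬ (x ≡ I × y ≡ suc I) → x′ < y′
adjacentSwap-< left          left          x<y _ = ⊥-elim (<-irrefl refl x<y)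
adjacentSwap-< left          right         _   ¬IJ = ⊥-elim (¬IJ (refl , refl))
adjacentSwap-< left          (fixed _ y≢J) x<y _ = ≤∧≢⇒< x<y (λ J≡y → y≢J (sym J≡y))
adjacentSwap-< right         left          x<y _ = ⊥-elim (<-asym x<y (n<1+n _))
adjacentSwap-< right         right         x<y _ = ⊥-elim (<-irrefl refl x<y)
adjacentSwap-< right         (fixed _ _)   x<y _ = <-trans (n<1+n _) x<y
adjacentSwap-< (fixed _ _)   left          x<y _ = m<n⇒m<1+n x<y
adjacentSwap-< (fixed x≢I _) right         x<y _ = ≤∧≢⇒< (s≤s⁻¹ x<y) x≢I
adjacentSwap-< (fixed _ _)   (fixed _ _)   x<y _ = x<y

module AdjacentTransposition {n} (i j : Fin n) (j≡1+i : toℕ j ≡ suc (toℕ i)) where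

  t : Fin n → Fin n
  t = PC.transpose i j

  i≢j : i ≢ j
  i≢j i≡j = <-irrefl (cong toℕ i≡j) (≤-reflexive (sym j≡1+i))

  transpose-i : t i ≡ j
  transpose-i rewrite dec-true (i ≟ᶠ i) refl = refl

  transpose-j : t j ≡ i
  transpose-j rewrite dec-false (j ≟ᶠ i) (λ j≡i → i≢j (sym j≡i)) | dec-true (j ≟ᶠ j) refl = refl

  transpose-other : ∀ {k} → k ≢ i → k ≢ j → t k ≡ k
  transpose-other {k} k≢i k≢j rewrite dec-false (k ≟ᶠ i) k≢i | dec-false (k ≟ᶠ j) k≢j = refl

  toℕ-transpose : ∀ k → AdjacentSwap (toℕ i) (toℕ k) (toℕ (t k))
  toℕ-transpose k = swap-of k (k ≟ᶠ i) (k ≟ᶠ j)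
    where
    swap-of : ∀ k → Dec (k ≡ i) → Dec (k ≡ j) → AdjacentSwap (toℕ i) (toℕ k) (toℕ (t k))
    swap-of k (yes refl) _        rewrite transpose-i | j≡1+i = left
    swap-of k (no k≢i)   (yes refl) rewrite transpose-j | j≡1+i = right
    swap-of k (no k≢i)   (no k≢j) rewrite transpose-other k≢i k≢j =
      fixed (λ k≡i → k≢i (toℕ-injective k≡i)) (λ k≡J → k≢j (toℕ-injective (trans k≡J (sym j≡1+i))))

  transpose-involutive : ∀ k → t (t k) ≡ k
  transpose-involutive k = toℕ-injective (adjacentSwap-involutive (toℕ-transpose k) (toℕ-transpose (t k)))

  transpose-< : ∀ {a b} → toℕ a < toℕ b → ¬ (a ≡ i × b ≡ j) → toℕ (t a) < toℕ (t b)
  transpose-< a<b ¬ij = adjacentSwap-< (toℕ-transpose _) (toℕ-transpose _) a<b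
    (λ (a≡i , b≡J) → ¬ij (toℕ-injective a≡i , toℕ-injective (trans b≡J (sym j≡1+i))))

  transpose-<⁻ : ∀ {a b} → toℕ (t a) < toℕ (t b) → ¬ (a ≡ j × b ≡ i) → toℕ a < toℕ b
  transpose-<⁻ {a} {b} ta<tb ¬ji =
    subst₂ (λ x y → toℕ x < toℕ y) (transpose-involutive a) (transpose-involutive b)
      (transpose-< ta<tb λ (ta≡i , tb≡j) → ¬ji (swapped-back a ta≡i transpose-i , swapped-back b tb≡j transpose-j))
    where
    swapped-back : ∀ x {y z} → t x ≡ y → t y ≡ z → x ≡ z
    swapped-back x tx≡y ty≡z = trans (sym (transpose-involutive x)) (trans (cong t tx≡y) ty≡z)

  inversion-∘-transpose : ∀ u → toℕ (u i) < toℕ (u j) → ∀ a b →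
    indicator (inversion? (u ∘ t) a b) ≡
    indicator (inversion? u (t a) (t b)) + indicator ((a ≟ᶠ i) ×-dec (b ≟ᶠ j))
  inversion-∘-transpose u ui<uj a b with (a ≟ᶠ i) ×-dec (b ≟ᶠ j)
  ... | yes (refl , refl) = begin
    indicator (inversion? (u ∘ t) i j)   ≡⟨ indicator-yes (inversion? (u ∘ t) i j) (≤-reflexive (sym j≡1+i) , ut-j<ut-i) ⟩
    1                                    ≡⟨ cong (_+ 1) (sym (indicator-no (inversion? u (t i) (t j)) ¬t-i<t-j)) ⟩
    indicator (inversion? u (t i) (t j)) + 1 ∎
    where
    open ≡-Reasoning
    ut-j<ut-i : toℕ (u (t j)) < toℕ (u (t i))
    ut-j<ut-i = subst₂ (λ x y → toℕ (u x) < toℕ (u y)) (sym transpose-j) (sym transpose-i) ui<uj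
    ¬t-i<t-j : ¬ Inversion u (t i) (t j)
    ¬t-i<t-j (ti<tj , _) = <-asym (subst₂ (λ x y → toℕ x < toℕ y) transpose-i transpose-j ti<tj)
                                  (≤-reflexive (sym j≡1+i))
  ... | no ¬ij = trans
    (indicator-cong (inversion? (u ∘ t) a b) (inversion? u (t a) (t b))
      (λ (a<b , utb<uta) → transpose-< a<b ¬ij , utb<uta)
      (λ (ta<tb , utb<uta) → transpose-<⁻ ta<tb (¬ji utb<uta) , utb<uta))
    (sym (+-identityʳ _))
    where
    ¬ji : toℕ (u (t b)) < toℕ (u (t a)) → ¬ (a ≡ j × b ≡ i)
    ¬ji utb<uta (refl , refl) =
      <-asym ui<uj (subst₂ (λ x y → toℕ (u x) < toℕ (u y)) transpose-i transpose-j utb<uta)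

  inversions-∘-transpose : ∀ u → toℕ (u i) < toℕ (u j) → inversions (u ∘ t) ≡ suc (inversions u)
  inversions-∘-transpose u ui<uj = begin
    inversions (u ∘ t)
      ≡⟨ sum-cong-≗ (λ a → sum-cong-≗ (inversion-∘-transpose u ui<uj a)) ⟩
    ∑[ a < n ] ∑[ b < n ] (F (t a) (t b) + δ a b)
      ≡⟨ sum-cong-≗ (λ a → ∑-distrib-+ (λ b → F (t a) (t b)) (δ a)) ⟩
    ∑[ a < n ] (∑[ b < n ] F (t a) (t b) + ∑[ b < n ] δ a b)
      ≡⟨ ∑-distrib-+ (λ a → ∑[ b < n ] F (t a) (t b)) (λ a → ∑[ b < n ] δ a b) ⟩
    ∑[ a < n ] ∑[ b < n ] F (t a) (t b) + ∑[ a < n ] ∑[ b < n ] δ a b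
      ≡⟨ cong₂ _+_ (sym reindex) δ-total ⟩
    inversions u + 1
      ≡⟨ +-comm (inversions u) 1 ⟩
    suc (inversions u) ∎
    where
    open ≡-Reasoning
    F : Fin n → Fin n → ℕ
    F a b = indicator (inversion? u a b)
    δ : Fin n → Fin n → ℕ
    δ a b = indicator ((a ≟ᶠ i) ×-dec (b ≟ᶠ j))
    reindex : inversions u ≡ ∑[ a < n ] ∑[ b < n ] F (t a) (t b)
    reindex = trans (sum-cong-≗ (λ a → sum-permute (F a) (Perm.transpose i j)))
                    (sum-permute (λ a → ∑[ b < n ] F a (t b)) (Perm.transpose i j))
    δ-row : ∀ a → ∑[ b < n ] δ a b ≡ indicator (a ≟ᶠ i)
    δ-row a with a ≟ᶠ i
    ... | yes refl = trans (sum-cong-≗ λ b → indicator-cong (yes refl ×-dec (b ≟ᶠ j)) (b ≟ᶠ j) proj₂ (refl ,_))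
                           (sum-indicator-≡ j)
    ... | no a≢i   = sum-zero _ (λ b → indicator-no (no a≢i ×-dec (b ≟ᶠ j)) (λ (a≡i , _) → a≢i a≡i))
    δ-total : ∑[ a < n ] ∑[ b < n ] δ a b ≡ 1
    δ-total = trans (sum-cong-≗ δ-row) (sum-indicator-≡ i)

-- A criterion for the right weak order

≤R-reflexive : ∀ {n} {u u′ : Fin n → Fin n} → u′ ≗ u → u ≤R u′
≤R-reflexive u′≗u = [] , u′≗u , λ { zero _ → sym (+-identityʳ _) }

≤R-step : ∀ {n} {u u′ : Fin n → Fin n} (s : SimpleRefl n) →
          inv (rmul u s) ≡ suc (inv u) → rmul u s ≤R u′ → u ≤R u′
≤R-step {u = u} s inv-us≡1+inv-u (ss , u′≗ , lengths) = s ∷ ss , u′≗ , lengths′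
  where
  lengths′ : ∀ k → k ≤ suc (length ss) → inv (rmulWord u (take k (s ∷ ss))) ≡ inv u + k
  lengths′ zero    _         = sym (+-identityʳ (inv u))
  lengths′ (suc k) (s≤s k≤) =
    trans (lengths k k≤) (trans (cong (_+ k) inv-us≡1+inv-u) (sym (+-suc (inv u) k)))

module _ {n} (f : Fin n → Fin n)
         (ascent : ∀ i j → toℕ j ≡ suc (toℕ i) → toℕ (f i) < toℕ (f j)) where

  private
    ascent-fromℕ< : ∀ {m} .(m<n : m < n) .(1+m<n : suc m < n) →
                    toℕ (f (fromℕ< m<n)) < toℕ (f (fromℕ< 1+m<n))
    ascent-fromℕ< m<n 1+m<n = ascent _ _ (trans (toℕ-fromℕ< 1+m<n) (cong suc (sym (toℕ-fromℕ< m<n))))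

    ≤-ascending : ∀ m (m<n : m < n) → m ≤ toℕ (f (fromℕ< m<n))
    ≤-ascending zero    _     = z≤n
    ≤-ascending (suc m) 1+m<n = ≤-trans (s≤s (≤-ascending m m<n)) (ascent-fromℕ< m<n 1+m<n)
      where m<n = <-trans (n<1+n m) 1+m<n

    ascending-+-< : ∀ r m (m+r<n : m + r < n) → toℕ (f (fromℕ< (≤-<-trans (m≤m+n m r) m+r<n))) + r < n
    ascending-+-< zero    m m+0<n = subst (_< n) (sym (+-identityʳ _)) (toℕ<n _)
    ascending-+-< (suc r) m m+1+r<n = begin-strict
      toℕ (f (fromℕ< m<n)) + suc r    ≡⟨ +-suc _ r ⟩
      suc (toℕ (f (fromℕ< m<n))) + r  ≤⟨ +-monoˡ-≤ r (ascent-fromℕ< m<n 1+m<n) ⟩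
      toℕ (f (fromℕ< 1+m<n)) + r      <⟨ ascending-+-< r (suc m) 1+m+r<n ⟩
      n                               ∎
      where
      open ≤-Reasoning
      1+m+r<n : suc m + r < n
      1+m+r<n = subst (_< n) (+-suc m r) m+1+r<n
      m<n = ≤-<-trans (m≤m+n m (suc r)) m+1+r<n
      1+m<n = ≤-<-trans (m≤m+n (suc m) r) 1+m+r<n

  adjacent-ascents⇒≗id : ∀ k → f k ≡ k
  adjacent-ascents⇒≗id k = toℕ-injective (≤-antisym fk≤k k≤fk)
    where
    k<n = toℕ<n k
    r = n ∸ suc (toℕ k)
    1+k+r≡n : suc (toℕ k) + r ≡ n
    1+k+r≡n = m+[n∸m]≡n k<n
    k≤fk : toℕ k ≤ toℕ (f k)
    k≤fk = subst (λ x → toℕ k ≤ toℕ (f x)) (fromℕ<-toℕ k k<n) (≤-ascending (toℕ k) k<n)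
    fk+r<1+k+r : toℕ (f k) + r < suc (toℕ k) + r
    fk+r<1+k+r = subst₂ (λ x y → toℕ (f x) + r < y) (fromℕ<-toℕ k k<n) (sym 1+k+r≡n)
                   (ascending-+-< r (toℕ k) (≤-reflexive 1+k+r≡n))
    fk≤k : toℕ (f k) ≤ toℕ k
    fk≤k = s≤s⁻¹ (+-cancelʳ-< r (toℕ (f k)) (suc (toℕ k)) fk+r<1+k+r)

module _ {n} (v : Permutation′ n) where

  private
    relative : (Fin n → Fin n) → Fin n → Fin n
    relative u k = v ⟨$⟩ˡ u k

    InversionsAscend : (Fin n → Fin n) → Set
    InversionsAscend u = ∀ {p q} → Inversion (relative u) p q → toℕ (u p) < toℕ (u q)

    AdjacentDescent : (Fin n → Fin n) → Fin n → Fin n → Set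
    AdjacentDescent σ i j = (toℕ j ≡ suc (toℕ i)) × (toℕ (σ j) < toℕ (σ i))

    adjacentDescent? : ∀ σ → Dec (∃ λ i → ∃ λ j → AdjacentDescent σ i j)
    adjacentDescent? σ = any? λ i → any? λ j →
      (toℕ j ≟ suc (toℕ i)) ×-dec (suc (toℕ (σ j)) ≤? toℕ (σ i))

    relative-injective : ∀ {u} → Injective _≡_ _≡_ u → Injective _≡_ _≡_ (relative u)
    relative-injective u-inj σa≡σb =
      u-inj (trans (sym (inverseʳ v)) (trans (cong (v ⟨$⟩ʳ_) σa≡σb) (inverseʳ v)))

    no-adjacent-descent⇒≤R : ∀ {u} → Injective _≡_ _≡_ u →
      ¬ (∃ λ i → ∃ λ j → AdjacentDescent (relative u) i j) → u ≤R (v ⟨$⟩ʳ_)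
    no-adjacent-descent⇒≤R {u} u-inj ¬descent = ≤R-reflexive λ k →
      trans (cong (v ⟨$⟩ʳ_) (sym (adjacent-ascents⇒≗id (relative u) ascent k))) (inverseʳ v)
      where
      ascent : ∀ i j → toℕ j ≡ suc (toℕ i) → toℕ (relative u i) < toℕ (relative u j)
      ascent i j j≡1+i = ≤∧≢⇒< (≮⇒≥ λ σj<σi → ¬descent (i , j , j≡1+i , σj<σi))
        λ σi≡σj → <-irrefl (cong toℕ (relative-injective u-inj (toℕ-injective σi≡σj))) (≤-reflexive (sym j≡1+i))

    ≤R-by-inversions : ∀ m u → inversions (relative u) ≡ m →
                       Injective _≡_ _≡_ u → InversionsAscend u → u ≤R (v ⟨$⟩ʳ_)
    ≤R-by-inversions m u _ u-inj _ with adjacentDescent? (relative u)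
    ... | no ¬descent = no-adjacent-descent⇒≤R u-inj ¬descent
    ≤R-by-inversions m u inv≡m u-inj ascend | yes (i , j , j≡1+i , σj<σi) = ≤R-step s inv-ut≡1+inv-u (ut≤R m inv≡m)
      where
      open AdjacentTransposition i j j≡1+i
      s : SimpleRefl n
      s = i , j , j≡1+i
      σ′ : Fin n → Fin n
      σ′ = relative (u ∘ t)
      σ′i<σ′j : toℕ (σ′ i) < toℕ (σ′ j)
      σ′i<σ′j = subst₂ (λ x y → toℕ (relative u x) < toℕ (relative u y)) (sym transpose-i) (sym transpose-j) σj<σi
      inv-σ≡1+inv-σ′ : inversions (relative u) ≡ suc (inversions σ′)
      inv-σ≡1+inv-σ′ = trans (inversions-cong λ k → cong (relative u) (sym (transpose-involutive k)))
                             (inversions-∘-transpose σ′ σ′i<σ′j)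
      inv-ut≡1+inv-u : inv (u ∘ t) ≡ suc (inv u)
      inv-ut≡1+inv-u = trans (inv≡inversions (u ∘ t))
        (trans (inversions-∘-transpose u (ascend (≤-reflexive (sym j≡1+i) , σj<σi)))
               (cong suc (sym (inv≡inversions u))))
      ut-injective : Injective _≡_ _≡_ (u ∘ t)
      ut-injective {a} {b} uta≡utb =
        trans (sym (transpose-involutive a)) (trans (cong t (u-inj uta≡utb)) (transpose-involutive b))
      ut-ascend : InversionsAscend (u ∘ t)
      ut-ascend (p<q , σ′q<σ′p) = ascend (transpose-< p<q ¬ij , σ′q<σ′p)
        where
        ¬ij : ¬ (_ ≡ i × _ ≡ j)
        ¬ij (refl , refl) = <-asym σ′i<σ′j σ′q<σ′p
      ut≤R : ∀ m → inversions (relative u) ≡ m → (u ∘ t) ≤R (v ⟨$⟩ʳ_)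
      ut≤R zero    inv≡0    = ⊥-elim (0≢1+n (trans (sym inv≡0) inv-σ≡1+inv-σ′))
      ut≤R (suc m) inv≡1+m  =
        ≤R-by-inversions m (u ∘ t) (suc-injective (trans (sym inv-σ≡1+inv-σ′) inv≡1+m)) ut-injective ut-ascend

  ascending-on-inversions⇒≤R : (u : Fin n → Fin n) → Injective _≡_ _≡_ u →
    (∀ {p q} → Inversion (λ k → v ⟨$⟩ˡ u k) p q → toℕ (u p) < toℕ (u q)) → u ≤R (v ⟨$⟩ʳ_)
  ascending-on-inversions⇒≤R u = ≤R-by-inversions _ u refl

-- The greedy construction of v′

permutation-injective : ∀ {n} (π : Permutation′ n) → Injective _≡_ _≡_ (π ⟨$⟩ʳ_)
permutation-injective π = Injection.injective (↔⇒↣ π)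

∉-∷ʳ : ∀ {A : Set} {xs : List A} {x} → Unique (xs ++ x ∷ []) → x ∉ xs
∉-∷ʳ {xs = y ∷ xs} (y≢ ∷ _) (here x≡y) = All.lookup y≢ (∈-++⁺ʳ xs (here refl)) (sym x≡y)
∉-∷ʳ {xs = y ∷ xs} (_ ∷ u)  (there x∈) = ∉-∷ʳ u x∈

unique-∷ʳ : ∀ {A : Set} {xs : List A} {x} → Unique xs → x ∉ xs → Unique (xs ++ x ∷ [])
unique-∷ʳ u x∉ = ++⁺ u (All.[] ∷ []) λ { (x∈ , here refl) → x∉ x∈ }

length-sortedVals : ∀ {n} (xs : List (Fin n)) → length (sortedVals xs) ≡ length xs
length-sortedVals xs = trans (↭-length (sort-↭ (map toℕ xs))) (length-map toℕ xs)

module _ {n} (π : Permutation′ n) where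

  sortedVals-∷ʳ : ∀ xs x → sortedVals (map (π ⟨$⟩ʳ_) (xs ++ x ∷ [])) ≡ insert (toℕ (π ⟨$⟩ʳ x)) (sortedVals (map (π ⟨$⟩ʳ_) xs))
  sortedVals-∷ʳ xs x = begin
    sort (map toℕ (map (π ⟨$⟩ʳ_) (xs ++ x ∷ [])))
      ≡⟨ cong (sort ∘ map toℕ) (map-++ (π ⟨$⟩ʳ_) xs (x ∷ [])) ⟩
    sort (map toℕ (map (π ⟨$⟩ʳ_) xs ++ (π ⟨$⟩ʳ x) ∷ []))
      ≡⟨ cong sort (map-++ toℕ (map (π ⟨$⟩ʳ_) xs) ((π ⟨$⟩ʳ x) ∷ [])) ⟩
    sort (map toℕ (map (π ⟨$⟩ʳ_) xs) ++ toℕ (π ⟨$⟩ʳ x) ∷ [])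
      ≡⟨ sort-∷ʳ (map toℕ (map (π ⟨$⟩ʳ_) xs)) (toℕ (π ⟨$⟩ʳ x)) ⟩
    insert (toℕ (π ⟨$⟩ʳ x)) (sortedVals (map (π ⟨$⟩ʳ_) xs)) ∎
    where open ≡-Reasoning

  ∈-sortedVals⁺ : ∀ {x xs} → x ∈ xs → toℕ (π ⟨$⟩ʳ x) ∈ sortedVals (map (π ⟨$⟩ʳ_) xs)
  ∈-sortedVals⁺ x∈ = ∈-sort⁺ _ (∈-map⁺ toℕ (∈-map⁺ (π ⟨$⟩ʳ_) x∈))

  ∈-sortedVals⁻ : ∀ {x xs} → toℕ (π ⟨$⟩ʳ x) ∈ sortedVals (map (π ⟨$⟩ʳ_) xs) → x ∈ xs
  ∈-sortedVals⁻ {xs = xs} πx∈ with ∈-map⁻ toℕ (∈-sort⁻ (map toℕ (map (π ⟨$⟩ʳ_) xs)) πx∈)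
  ... | y , y∈ , πx≡y with ∈-map⁻ (π ⟨$⟩ʳ_) y∈
  ...   | z , z∈ , refl = subst (_∈ xs) (sym (permutation-injective π (toℕ-injective πx≡y))) z∈

  ascending-sortedVals : ∀ {xs} → Unique xs → Ascending 0 (sortedVals (map (π ⟨$⟩ʳ_) xs))
  ascending-sortedVals []            = []
  ascending-sortedVals (x≢ ∷ xs-uniq) =
    insert-ascending (ascending-sortedVals xs-uniq) z≤n
      (λ πx∈ → Unique[x∷xs]⇒x∉xs (x≢ ∷ xs-uniq) (∈-sortedVals⁻ πx∈))

module _ {A : Set} {P : A → Set} (P? : ∀ a → Dec (P a)) where

  firstSat-complete : ∀ xs {c} → c ∈ xs → P c → ∃ λ b → firstSat P? xs ≡ just b
  firstSat-complete (x ∷ xs) c∈ pc with P? x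
  firstSat-complete (x ∷ xs) c∈          pc | yes _  = x , refl
  firstSat-complete (x ∷ xs) (here refl) pc | no ¬px = ⊥-elim (¬px pc)
  firstSat-complete (x ∷ xs) (there c∈)  pc | no _   = firstSat-complete xs c∈ pc

  firstSat-sound : ∀ xs {b} → firstSat P? xs ≡ just b → P b
  firstSat-sound (x ∷ xs) first≡b with P? x
  firstSat-sound (x ∷ xs) refl    | yes px = px
  firstSat-sound (x ∷ xs) first≡b | no _   = firstSat-sound xs first≡b

  firstSat-tabulate-least : ∀ {m} (f : Fin m → A) {b} → firstSat P? (tabulate f) ≡ just b →
    ∃ λ d → f d ≡ b × (∀ d′ → toℕ d′ < toℕ d → ¬ P (f d′))
  firstSat-tabulate-least {suc m} f first≡b with P? (f zero)
  firstSat-tabulate-least {suc m} f refl    | yes _ = zero , refl , λ _ ()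
  firstSat-tabulate-least {suc m} f first≡b | no ¬p0
    with firstSat-tabulate-least (f ∘ suc) first≡b
  ... | d , fd≡b , least = suc d , fd≡b , λ { zero _ → ¬p0 ; (suc d′) d′<d → least d′ (s≤s⁻¹ d′<d) }

length-∷ʳ : ∀ {A : Set} (xs : List A) x → length (xs ++ x ∷ []) ≡ suc (length xs)
length-∷ʳ xs x = trans (length-++ xs) (+-comm (length xs) 1)

module Greedy {n} (w v : Permutation′ n) where

  values : List (Fin n) → List ℕ
  values ch = sortedVals (map (v ⟨$⟩ʳ_) ch)

  wUpTo-ascending : ∀ k → Ascending 0 (wUpTo w k)
  wUpTo-ascending k = ascending-sortedVals w (take⁺ k (allFin⁺ n))

  wUpTo-suc : ∀ i → wUpTo w (suc (toℕ i)) ≡ insert (toℕ (w ⟨$⟩ʳ i)) (wUpTo w (toℕ i))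
  wUpTo-suc i = trans (cong (sortedVals ∘ map (w ⟨$⟩ʳ_)) (take-suc-tabulate (λ k → k) i))
                      (sortedVals-∷ʳ w (take (toℕ i) (allFin n)) i)

  w-∉-wUpTo : ∀ i → toℕ (w ⟨$⟩ʳ i) ∉ wUpTo w (toℕ i)
  w-∉-wUpTo i wi∈ = ∉-∷ʳ (subst Unique (take-suc-tabulate (λ k → k) i) (take⁺ (suc (toℕ i)) (allFin⁺ n)))
                         (∈-sortedVals⁻ w wi∈)

  Admissible : List (Fin n) → Set
  Admissible ch = Unique ch × values ch ≤tup wUpTo w (length ch)

  admissible-∷ʳ : ∀ {ch i} → Admissible ch → Cand w v ch i → Admissible (ch ++ i ∷ [])
  admissible-∷ʳ {ch} {i} (ch-uniq , _) (i∉ch , chi≤w) =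
    unique-∷ʳ ch-uniq i∉ch , subst (λ k → values (ch ++ i ∷ []) ≤tup wUpTo w k) (sym (length-∷ʳ ch i)) chi≤w

  -- The position holding the least value not yet chosen is always a candidate.
  candidate-exists : ∀ {ch} → Admissible ch → length ch < n → ∃ (Cand w v ch)
  candidate-exists {ch} (ch-uniq , ch≤w) k<n = c , c∉ch , c-admissible
    where
    k = length ch
    values↑ = ascending-sortedVals v ch-uniq
    m<n : mex 0 (values ch) < n
    m<n = ≤-<-trans (≤-trans (mex-≤-+-length 0 (values ch))
                             (≤-reflexive (trans (length-sortedVals (map (v ⟨$⟩ʳ_) ch)) (length-map _ ch))))
                    k<n
    c : Fin n
    c = v ⟨$⟩ˡ fromℕ< m<n
    vc≡m : toℕ (v ⟨$⟩ʳ c) ≡ mex 0 (values ch)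
    vc≡m = trans (cong toℕ (inverseʳ v)) (toℕ-fromℕ< m<n)
    c∉ch : c ∉ ch
    c∉ch c∈ = mex-∉ values↑ (subst (_∈ values ch) vc≡m (∈-sortedVals⁺ v c∈))
    i : Fin n
    i = fromℕ< k<n
    w-k : wUpTo w (suc k) ≡ insert (toℕ (w ⟨$⟩ʳ i)) (wUpTo w k)
    w-k = subst (λ x → wUpTo w (suc x) ≡ insert (toℕ (w ⟨$⟩ʳ i)) (wUpTo w x)) (toℕ-fromℕ< k<n) (wUpTo-suc i)
    c-admissible : values (ch ++ c ∷ []) ≤tup wUpTo w (suc k)
    c-admissible = subst₂ _≤tup_
      (sym (trans (sortedVals-∷ʳ v ch c) (cong (λ x → insert x (values ch)) vc≡m)))
      (sym w-k)
      (insert-mex-≤tup-insert (toℕ (w ⟨$⟩ʳ i)) values↑ (wUpTo-ascending k)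
        (subst (λ x → toℕ (w ⟨$⟩ʳ i) ∉ wUpTo w x) (toℕ-fromℕ< k<n) (w-∉-wUpTo i)) ch≤w)

  data Run (ch : List (Fin n)) : (m : ℕ) → Vec (Fin n) m → Set where
    []  : Run ch 0 []
    _∷_ : ∀ {m i is} → nextIdx w v ch ≡ just i → Run (ch ++ i ∷ []) m is → Run ch (suc m) (i ∷ is)

  next-cand : ∀ {ch i} → nextIdx w v ch ≡ just i → Cand w v ch i
  next-cand = firstSat-sound (cand? w v _) (allFin n)

  greedy-run : ∀ m ch → length ch + m ≡ n → Admissible ch →
               ∃ λ is → greedy w v m ch ≡ just is × Run ch m is
  greedy-run zero    ch _   _   = [] , refl , []
  greedy-run (suc m) ch k+m≡n adm
    with candidate-exists adm (subst (length ch <_) k+m≡n (m<m+n (length ch) z<s))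
  ... | c , c-cand with firstSat-complete (cand? w v ch) (allFin n) (∈-allFin c) c-cand
  ... | i , next≡i with greedy-run m (ch ++ i ∷ []) k+1+m≡n (admissible-∷ʳ adm (next-cand next≡i))
    where
    k+1+m≡n : length (ch ++ i ∷ []) + m ≡ n
    k+1+m≡n = trans (cong (_+ m) (length-∷ʳ ch i)) (trans (sym (+-suc (length ch) m)) k+m≡n)
  ... | is , greedy≡is , run rewrite next≡i | greedy≡is = i ∷ is , refl , next≡i ∷ run

  run-fresh : ∀ {ch m is} → Run ch m is → ∀ k → lookup is k ∉ ch
  run-fresh (next≡i ∷ _) zero    = proj₁ (next-cand next≡i)
  run-fresh (_ ∷ run)    (suc k) = run-fresh run k ∘ ∈-++⁺ˡ

  run-injective : ∀ {ch m is} → Run ch m is → Injective _≡_ _≡_ (lookup is)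
  run-injective run {zero}  {zero}  _    = refl
  run-injective {ch} (_ ∷ run) {zero} {suc q} i≡isq =
    ⊥-elim (run-fresh run q (subst (_∈ ch ++ _ ∷ []) i≡isq (∈-++⁺ʳ ch (here refl))))
  run-injective {ch} (_ ∷ run) {suc p} {zero} isp≡i =
    ⊥-elim (run-fresh run p (subst (_∈ ch ++ _ ∷ []) (sym isp≡i) (∈-++⁺ʳ ch (here refl))))
  run-injective (_ ∷ run) {suc p} {suc q} isp≡isq = cong suc (run-injective run isp≡isq)

  -- An earlier position carrying a smaller value would have been a candidate
  -- when the later one was chosen, contradicting the minimality of i_k.
  run-earliest : ∀ {ch m is} → Unique ch → Run ch m is → ∀ {p q} → Inversion (lookup is) p q →
                 ¬ (toℕ (v ⟨$⟩ʳ lookup is q) < toℕ (v ⟨$⟩ʳ lookup is p))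
  run-earliest {ch} ch-uniq (_∷_ {i = i} {is = is} next≡i run) {zero} {suc q} (_ , a<i) va<vi
    with firstSat-tabulate-least (cand? w v ch) (λ k → k) next≡i
  ... | _ , refl , least = least a a<i (a∉ch , a-admissible)
    where
    a = lookup is q
    a∉ch : a ∉ ch
    a∉ch = run-fresh run q ∘ ∈-++⁺ˡ
    a-admissible : values (ch ++ a ∷ []) ≤tup wUpTo w (suc (length ch))
    a-admissible = ≤tup-trans
      (subst (_≤tup insert (toℕ (v ⟨$⟩ʳ i)) (values ch)) (sym (sortedVals-∷ʳ v ch a))
        (insert-monoˡ-≤tup (<⇒≤ va<vi) (ascending-sortedVals v ch-uniq)))
      (subst (_≤tup wUpTo w (suc (length ch))) (sortedVals-∷ʳ v ch i) (proj₂ (next-cand next≡i)))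
  run-earliest ch-uniq (next≡i ∷ run) {suc p} {suc q} (p<q , isq<isp) =
    run-earliest (unique-∷ʳ ch-uniq (proj₁ (next-cand next≡i))) run (s≤s⁻¹ p<q , isq<isp)

  run-inversions-ascend : ∀ {ch m is} → Unique ch → Run ch m is → ∀ {p q} → Inversion (lookup is) p q →
                          toℕ (v ⟨$⟩ʳ lookup is p) < toℕ (v ⟨$⟩ʳ lookup is q)
  run-inversions-ascend ch-uniq run pq-inversion@(p<q , _) =
    ≤∧≢⇒< (≮⇒≥ (run-earliest ch-uniq run pq-inversion))
      λ vp≡vq → <-irrefl (cong toℕ (run-injective run (permutation-injective v (toℕ-injective vp≡vq)))) p<q

lemma4p1 : (n : ℕ) (w v : Permutation′ n) →
    Σ (Vec (Fin n) n) λ is →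
      (primeIndices w v ≡ just is) × (primeOf v is ≤R (v ⟨$⟩ʳ_))
lemma4p1 n w v with Greedy.greedy-run w v n [] refl ([] , [])
... | is , greedy≡is , run = is , greedy≡is , ascending-on-inversions⇒≤R v (primeOf v is) v′-injective v′-ascend
  where
  open Greedy w v
  v′-injective : Injective _≡_ _≡_ (primeOf v is)
  v′-injective = run-injective run ∘ permutation-injective v
  v′-ascend : ∀ {p q} → Inversion (λ k → v ⟨$⟩ˡ primeOf v is k) p q → toℕ (primeOf v is p) < toℕ (primeOf v is q)
  v′-ascend (p<q , isq<isp) =
    run-inversions-ascend [] run (p<q , subst₂ (λ x y → toℕ x < toℕ y) (inverseˡ v) (inverseˡ v) isq<isp)
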